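{- Let $n\ge1$ and $\alpha\in\mathscr M_n$. Then $\alpha^2=\alpha$ if and only if each connected component of the interface graph $\Gamma(\alpha)$ is either a cycle, an inert path, or a trans-active path.
   Context: Upper vertices $[n]=\{1,\dots,n\}$, lower vertices $[n]'=\{1',\dots,n'\}$. The partition monoid $\mathscr P_n$ consists of set partitions of $[n]\cup[n]'$; to multiply $\alpha,\beta$, identify each lower vertex $i'$ of $\alpha$ with the upper vertex $i$ of $\beta$, take connected components of the union of blocks, and let $\alpha\beta$ be the induced partition on the upper vertices of $\alpha$ and lower vertices of $\beta$ (components entirely in the middle row are discarded). A partition is planar if, placing $i$ at $(i,1)$ and $i'$ at $(i,0)$, its blocks can be drawn as pairwise disjoint connected sets in $[1,n]\times[0,1]$. The Motzkin monoid $\mathscr M_n$ consists of planar partitions all of whose blocks have size 1 or 2. A block is transversal if it meets both $[n]$ and $[n]'$. Interface graph $\Gamma(\alpha)$: vertex set $[n]$, an upper edge $\{a,b\}$ for each block $\{a,b\}\subseteq[n]$ of $\alpha$ and a lower edge $\{a,b\}$ for each block $\{a',b'\}\subseteq[n]'$ (upper and lower edges distinguished; a double edge is a 2-cycle). Each vertex $i$ has an upper side, which is covered (if $i$ lies in a non-transversal 2-element block), active (if $i$ lies in a transversal block) or inert (if $\{i\}$ is a block); the lower side of $i$ is defined likewise using $i'$. Each component is a cycle or a path (possibly a single vertex). The free ends of a path are the sides of its end vertices not covered by edges of the path (for a one-vertex path, both sides of the vertex). A path is inert if both free ends are inert, and trans-active if both free ends are active and one is an upper side while the other is a lower side. -}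

module Defs where

open import Data.Nat using (ℕ; zero; suc; _+_; _∸_; _*_; _<_; _≤_)
open import Data.Fin using (Fin; toℕ)
open import Data.Sum using (_⊎_; inj₁; inj₂)
open import Data.Product using (Σ; ∃; _×_; _,_)
open import Data.Maybe using (Maybe; just; nothing)
open import Data.Bool using (Bool; true; false)
open import Relation.Nullary using (¬_)
open import Relation.Binary.PropositionalEquality using (_≡_)
open import Relation.Binary.Construct.Closure.ReflexiveTransitive using (Star)
open import Function.Bundles using (_⇔_)

-- Vertices of [n] ∪ [n]' : inj₁ i = upper vertex i, inj₂ i = lower vertex i'.

V : ℕ → Set
V n = Fin n ⊎ Fin n

isUpper : ∀ {n} → V n → Bool
isUpper (inj₁ _) = true
isUpper (inj₂ _) = false

-- Partitions of [n] ∪ [n]' as (equivalence) relations "same block",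
-- and the partition-monoid product.

PRel : ℕ → Set₁
PRel n = V n → V n → Set

-- three rows used when stacking α on top of β
data Row3 : Set where
  top mid bot : Row3

W : ℕ → Set
W n = Row3 × Fin n

ιˡ : ∀ {n} → V n → W n
ιˡ (inj₁ i) = top , i
ιˡ (inj₂ i) = mid , i

ιʳ : ∀ {n} → V n → W n
ιʳ (inj₁ i) = mid , i
ιʳ (inj₂ i) = bot , i

ιᵒ : ∀ {n} → V n → W n
ιᵒ (inj₁ i) = top , i
ιᵒ (inj₂ i) = bot , i

data StackEdge {n} (α β : PRel n) : W n → W n → Set where
  fromα : ∀ {x y} → α x y → StackEdge α β (ιˡ x) (ιˡ y)
  fromβ : ∀ {x y} → β x y → StackEdge α β (ιʳ x) (ιʳ y)

-- x and y lie in the same block of αβ iff they are connected in the stacked graph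
_⊙_ : ∀ {n} → PRel n → PRel n → PRel n
(α ⊙ β) x y = Star (StackEdge α β) (ιᵒ x) (ιᵒ y)

_≐_ : ∀ {n} → PRel n → PRel n → Set
A ≐ B = ∀ x y → A x y ⇔ B x y

-- Motzkin monoid: planar partitions with blocks of size 1 or 2,
-- represented by the partner map (nothing = singleton block).

-- position of a vertex along the boundary of the rectangle, traversed
-- 1, 2, …, n, n', …, 2', 1'
pos : ∀ {n} → V n → ℕ
pos {n} (inj₁ i) = toℕ i
pos {n} (inj₂ i) = n + (n ∸ suc (toℕ i))

record Motzkin (n : ℕ) : Set where
  field
    partner     : V n → Maybe (V n)
    symmetric   : ∀ x y → partner x ≡ just y → partner y ≡ just x
    irreflexive : ∀ x → ¬ (partner x ≡ just x)
    noncrossing : ∀ a b c d → partner a ≡ just b → partner c ≡ just d →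
                  ¬ (pos a < pos c × pos c < pos b × pos b < pos d)
open Motzkin public

blocks : ∀ {n} → Motzkin n → PRel n
blocks α x y = x ≡ y ⊎ partner α x ≡ just y

-- Sides and their status.  A side of vertex i is inj₁ i (upper side)
-- or inj₂ i (lower side), i.e. the vertex i or i' of α.

vertexOf : ∀ {n} → V n → Fin n
vertexOf (inj₁ i) = i
vertexOf (inj₂ i) = i

Covered : ∀ {n} → Motzkin n → V n → Set
Covered α s = Σ _ λ t → partner α s ≡ just t × isUpper s ≡ isUpper t

Active : ∀ {n} → Motzkin n → V n → Set
Active α s = Σ _ λ t → partner α s ≡ just t × ¬ (isUpper s ≡ isUpper t)

Inert : ∀ {n} → Motzkin n → V n → Set
Inert α s = partner α s ≡ nothing

data ΓEdge {n} (α : Motzkin n) : Fin n → Fin n → Set where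
  upper : ∀ {a b} → partner α (inj₁ a) ≡ just (inj₁ b) → ΓEdge α a b
  lower : ∀ {a b} → partner α (inj₂ a) ≡ just (inj₂ b) → ΓEdge α a b

Connected : ∀ {n} → Motzkin n → Fin n → Fin n → Set
Connected α = Star (ΓEdge α)

-- components are given by any representative vertex r.
-- A component is a cycle iff every side of each of its vertices is covered
-- by an edge (every vertex has degree 2, counting a double edge).
IsCycle : ∀ {n} → Motzkin n → Fin n → Set
IsCycle α r = ∀ i → Connected α r i → Covered α (inj₁ i) × Covered α (inj₂ i)

IsPath : ∀ {n} → Motzkin n → Fin n → Set
IsPath α r = ¬ IsCycle α r

-- free ends of the component of r: sides of its vertices not covered by
-- edges (for a path these are exactly the sides of its end vertices not
-- covered by edges of the path)
FreeEnd : ∀ {n} → Motzkin n → Fin n → V n → Set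
FreeEnd α r s = Connected α r (vertexOf s) × ¬ Covered α s

IsInertPath : ∀ {n} → Motzkin n → Fin n → Set
IsInertPath α r = IsPath α r × (∀ s → FreeEnd α r s → Inert α s)

IsTransActivePath : ∀ {n} → Motzkin n → Fin n → Set
IsTransActivePath α r =
  IsPath α r ×
  Σ (Fin _) λ i → Σ (Fin _) λ j →
    (∀ s → FreeEnd α r s ⇔ (s ≡ inj₁ i ⊎ s ≡ inj₂ j)) ×
    Active α (inj₁ i) × Active α (inj₂ j)

module Submission where

-- (⇐) The heart of the matter is that a trans-active path joins the two ends
-- of a transversal block {u, a′}: u and a lie in one component of Γ(α).
-- This is proved by induction from the left using planarity, in the form
-- "through lines do not cross": a walk in Γ(α) from an active upper side to
-- an active lower side cuts the rectangle in two, and counting modulo 2 the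
-- arcs separating a vertex shows that other components lie on one side.
-- Stacking two copies of α, the middle row then only ever connects the ends
-- of a transversal block through that component, so α² = α.
-- (⇒) If α² = α, stacking shows that a component containing an active side
-- contains a transversal block {k, m′} with both k and m in it; since the
-- sides of Γ(α) form a graph of maximum degree two, a path has at most two
-- free ends, which are therefore k and m′.

open import Defs
open import Data.Nat using (ℕ; zero; suc; _<_; _≤_; _<?_; _≟_; z≤n; s≤s)
open import Data.Nat.Properties using (<-cmp; <⇒≢; >⇒≢; <-asym; <-irrefl; n≮n; ≮⇒≥; ≤∧≢⇒<; ≤-pred; ≤-trans;
  <-≤-trans; m≤m+n; m≤n⇒m≤1+n; suc-injective; +-cancelˡ-<; +-monoʳ-<; +-cancelˡ-≡; ∸-cancelʳ-<;
  ∸-monoʳ-<; ∸-cancelˡ-≡)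
open import Data.Fin using (Fin; toℕ) renaming (zero to fz; suc to fs)
open import Data.Fin.Properties using (toℕ<n; toℕ-injective; any?; all?; ¬∀⟶∃¬) renaming (_≟_ to _≟F_)
import Data.Fin.Induction as FinInduction
open import Data.Sum using (_⊎_; inj₁; inj₂; swap)
open import Data.Sum.Properties using (inj₁-injective; inj₂-injective)
import Data.Sum.Properties as Sum
open import Data.Product using (Σ; _×_; _,_; proj₁; proj₂)
open import Data.Maybe using (Maybe; just; nothing)
open import Data.Maybe.Properties using (just-injective)
import Data.Maybe.Properties as Maybe
open import Data.Bool using (Bool; true; false; not; _xor_)
open import Data.Bool.Properties using (xor-same; xor-assoc; xor-comm; xor-annihilates-not)
import Data.Bool as Bool
open import Data.Empty using (⊥; ⊥-elim)
open import Level using (0ℓ)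
open import Induction.WellFounded using (module All)
open import Relation.Nullary using (¬_; Dec; yes; no; contradiction)
open import Relation.Nullary.Decidable using (_⊎-dec_; _×-dec_; _→-dec_; map′)
open import Relation.Binary using (tri<; tri≈; tri>)
open import Relation.Binary.PropositionalEquality
  using (_≡_; _≢_; refl; sym; trans; cong; cong₂; subst; module ≡-Reasoning)
open import Relation.Binary.Construct.Closure.ReflexiveTransitive using (Star; ε; _◅_; _◅◅_; reverse)
open import Function using (_∘_)
open import Function.Bundles using (_⇔_; mk⇔; Equivalence)

count : ∀ {m} {P : Fin m → Set} → (∀ i → Dec (P i)) → ℕ
count {zero}  P? = 0
count {suc m} P? with P? fz
... | yes _ = suc (count (λ i → P? (fs i)))
... | no _  = count (λ i → P? (fs i))

count≤ : ∀ {m} {P : Fin m → Set} (P? : ∀ i → Dec (P i)) → count P? ≤ m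
count≤ {zero}  P? = z≤n
count≤ {suc m} P? with P? fz
... | yes _ = s≤s (count≤ (λ i → P? (fs i)))
... | no _  = m≤n⇒m≤1+n (count≤ (λ i → P? (fs i)))

count-mono : ∀ {m} {P Q : Fin m → Set} (P? : ∀ i → Dec (P i)) (Q? : ∀ i → Dec (Q i)) →
  (∀ i → P i → Q i) → count P? ≤ count Q?
count-mono {zero}  P? Q? P⊆Q = z≤n
count-mono {suc m} P? Q? P⊆Q with P? fz | Q? fz
... | yes _ | yes _ = s≤s (count-mono _ _ (λ i → P⊆Q (fs i)))
... | yes p | no ¬q = contradiction (P⊆Q fz p) ¬q
... | no _  | yes _ = m≤n⇒m≤1+n (count-mono _ _ (λ i → P⊆Q (fs i)))
... | no _  | no _  = count-mono _ _ (λ i → P⊆Q (fs i))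

count-strict : ∀ {m} {P Q : Fin m → Set} (P? : ∀ i → Dec (P i)) (Q? : ∀ i → Dec (Q i)) →
  (∀ i → P i → Q i) → ∀ i₀ → Q i₀ → ¬ P i₀ → count P? < count Q?
count-strict {suc m} P? Q? P⊆Q i₀ q ¬p with P? fz | Q? fz | i₀
... | yes p | _     | fz    = contradiction p ¬p
... | no _  | no ¬q | fz    = contradiction q ¬q
... | no _  | yes _ | fz    = s≤s (count-mono _ _ (λ i → P⊆Q (fs i)))
... | yes p | no ¬q | fs _  = contradiction (P⊆Q fz p) ¬q
... | yes _ | yes _ | fs i  = s≤s (count-strict _ _ (λ i → P⊆Q (fs i)) i q ¬p)
... | no _  | yes _ | fs i  = m≤n⇒m≤1+n (count-strict _ _ (λ i → P⊆Q (fs i)) i q ¬p)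
... | no _  | no _  | fs i  = count-strict _ _ (λ i → P⊆Q (fs i)) i q ¬p

module Reachability {n : ℕ} (E : Fin n → Fin n → Set) (E? : ∀ a b → Dec (E a b)) (r : Fin n) where

  Within : ℕ → Fin n → Set
  Within zero    i = i ≡ r
  Within (suc k) i = Within k i ⊎ Σ (Fin n) λ j → Within k j × E j i

  within? : ∀ k i → Dec (Within k i)
  within? zero    i = i ≟F r
  within? (suc k) i = within? k i ⊎-dec any? (λ j → within? k j ×-dec E? j i)

  centre : ∀ k → Within k r
  centre zero    = refl
  centre (suc k) = inj₁ (centre k)

  within⇒reachable : ∀ k i → Within k i → Star E r i
  within⇒reachable zero    i refl                = ε
  within⇒reachable (suc k) i (inj₁ w)            = within⇒reachable k i w
  within⇒reachable (suc k) i (inj₂ (j , w , e)) = within⇒reachable k j w ◅◅ (e ◅ ε)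

  Saturated : ℕ → Set
  Saturated k = ∀ i → Within (suc k) i → Within k i

  saturated-step : ∀ k → Saturated k → Saturated (suc k)
  saturated-step k sat i (inj₁ w)            = w
  saturated-step k sat i (inj₂ (j , w , e)) = inj₂ (j , sat j w , e)

  saturated? : ∀ k → Dec (Saturated k)
  saturated? k = all? (λ i → within? (suc k) i →-dec within? k i)

  extend : ∀ k → ¬ Saturated k → count (within? k) < count (within? (suc k))
  extend k ¬sat with ¬∀⟶∃¬ n _ (λ i → within? (suc k) i →-dec within? k i) ¬sat
  ... | i , ¬incl with within? (suc k) i | within? k i
  ...   | _     | yes w = contradiction (λ _ → w) ¬incl
  ...   | no ¬w | no _  = contradiction (λ w → contradiction w ¬w) ¬incl
  ...   | yes w | no ¬w = count-strict (within? k) (within? (suc k)) (λ _ → inj₁) i w ¬w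

  grow : ∀ k → Saturated k ⊎ suc k ≤ count (within? (suc k))
  grow zero with saturated? zero
  ... | yes sat  = inj₁ sat
  ... | no ¬sat = inj₂ (<-≤-trans (s≤s z≤n) (extend zero ¬sat))
  grow (suc k) with grow k | saturated? (suc k)
  ... | inj₁ sat | _        = inj₁ (saturated-step k sat)
  ... | inj₂ _   | yes sat  = inj₁ sat
  ... | inj₂ big | no ¬sat = inj₂ (<-≤-trans (s≤s big) (extend (suc k) ¬sat))

  -- after n steps the ball can no longer grow, since it has at most n elements
  saturated : Saturated n
  saturated with grow n
  ... | inj₁ sat = sat
  ... | inj₂ big = contradiction (≤-trans big (count≤ (within? (suc n)))) (n≮n n)

  reachable⇒within : ∀ {i j} → Within n i → Star E i j → Within n j
  reachable⇒within w ε       = w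
  reachable⇒within w (e ◅ p) = reachable⇒within (saturated _ (inj₂ (_ , w , e))) p

  reachable? : ∀ i → Dec (Star E r i)
  reachable? i = map′ (within⇒reachable n i) (reachable⇒within (centre n)) (within? n i)

module MotzkinBasics {n : ℕ} (α : Motzkin n) where

  P : V n → Maybe (V n)
  P = partner α

  partner-sym : ∀ {x y} → P x ≡ just y → P y ≡ just x
  partner-sym {x} {y} = symmetric α x y

  partner-functional : ∀ {x y z} → P x ≡ just y → P x ≡ just z → y ≡ z
  partner-functional p q = just-injective (trans (sym p) q)

  partner-injective : ∀ {x y z} → P x ≡ just z → P y ≡ just z → x ≡ y
  partner-injective p q = partner-functional (partner-sym p) (partner-sym q)

  _≟V_ : (x y : V n) → Dec (x ≡ y)
  _≟V_ = Sum.≡-dec _≟F_ _≟F_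

  data Status (s : V n) : Set where
    covered : Covered α s → Status s
    active  : Active α s → Status s
    inert   : Inert α s → Status s

  status : ∀ s → Status s
  status s with P s in eq
  ... | nothing = inert eq
  ... | just t with isUpper s Bool.≟ isUpper t
  ...   | yes same = covered (t , eq , same)
  ...   | no other = active (t , eq , other)

  covered⇒¬active : ∀ {s} → Covered α s → ¬ Active α s
  covered⇒¬active (t , p , same) (t′ , p′ , other) =
    other (trans same (cong isUpper (partner-functional p p′)))

  covered⇒¬inert : ∀ {s} → Covered α s → ¬ Inert α s
  covered⇒¬inert (t , p , _) q with () ← trans (sym p) q

  active⇒¬inert : ∀ {s} → Active α s → ¬ Inert α s
  active⇒¬inert (t , p , _) q with () ← trans (sym p) q

  active⇒¬covered : ∀ {s} → Active α s → ¬ Covered α s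
  active⇒¬covered a c = covered⇒¬active c a

  covered? : ∀ s → Dec (Covered α s)
  covered? s with status s
  ... | covered c = yes c
  ... | active a  = no (active⇒¬covered a)
  ... | inert i   = no (λ c → covered⇒¬inert c i)

  active? : ∀ s → Dec (Active α s)
  active? s with status s
  ... | covered c = no (covered⇒¬active c)
  ... | active a  = yes a
  ... | inert i   = no (λ a → active⇒¬inert a i)

  active-upper : ∀ {k} → Active α (inj₁ k) → Σ (Fin n) λ m → P (inj₁ k) ≡ just (inj₂ m)
  active-upper (inj₁ _ , _ , other) = contradiction refl other
  active-upper (inj₂ m , p , _)     = m , p

  active-lower : ∀ {k} → Active α (inj₂ k) → Σ (Fin n) λ m → P (inj₂ k) ≡ just (inj₁ m)
  active-lower (inj₂ _ , _ , other) = contradiction refl other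
  active-lower (inj₁ m , p , _)     = m , p

  transversal-upper : ∀ {k m} → P (inj₁ k) ≡ just (inj₂ m) → Active α (inj₁ k)
  transversal-upper p = _ , p , λ ()

  transversal-lower : ∀ {k m} → P (inj₂ k) ≡ just (inj₁ m) → Active α (inj₂ k)
  transversal-lower p = _ , p , λ ()

  ActiveUpperIn ActiveLowerIn : Fin n → Set
  ActiveUpperIn r = Σ (Fin n) λ x → Connected α r x × Active α (inj₁ x)
  ActiveLowerIn r = Σ (Fin n) λ x → Connected α r x × Active α (inj₂ x)

  Γ-sym : ∀ {a b} → ΓEdge α a b → ΓEdge α b a
  Γ-sym (upper p) = upper (partner-sym p)
  Γ-sym (lower p) = lower (partner-sym p)

  connected-sym : ∀ {a b} → Connected α a b → Connected α b a
  connected-sym = reverse Γ-sym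

  Γ? : ∀ a b → Dec (ΓEdge α a b)
  Γ? a b = map′ fromSum toSum
    (Maybe.≡-dec _≟V_ (P (inj₁ a)) (just (inj₁ b)) ⊎-dec Maybe.≡-dec _≟V_ (P (inj₂ a)) (just (inj₂ b)))
    where
    fromSum : P (inj₁ a) ≡ just (inj₁ b) ⊎ P (inj₂ a) ≡ just (inj₂ b) → ΓEdge α a b
    fromSum (inj₁ p) = upper p
    fromSum (inj₂ p) = lower p
    toSum : ΓEdge α a b → P (inj₁ a) ≡ just (inj₁ b) ⊎ P (inj₂ a) ≡ just (inj₂ b)
    toSum (upper p) = inj₁ p
    toSum (lower p) = inj₂ p

  connected? : ∀ a b → Dec (Connected α a b)
  connected? a b = Reachability.reachable? (ΓEdge α) Γ? a b

xor-cancel-middle : ∀ a b c → (a xor b) xor (b xor c) ≡ a xor c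
xor-cancel-middle false false c = refl
xor-cancel-middle false true  false = refl
xor-cancel-middle false true  true  = refl
xor-cancel-middle true  false c = refl
xor-cancel-middle true  true  false = refl
xor-cancel-middle true  true  true  = refl

xor-swap : ∀ a b c → a xor (b xor c) ≡ b xor (a xor c)
xor-swap false b c = refl
xor-swap true false c = refl
xor-swap true true false = refl
xor-swap true true true = refl

xor-transpose : ∀ a b c d → a xor b ≡ c xor d → a xor c ≡ b xor d
xor-transpose a b c d h = begin
  a xor c                  ≡⟨ sym (xor-cancel-middle a b c) ⟩
  (a xor b) xor (b xor c)  ≡⟨ cong₂ _xor_ (trans h (xor-comm c d)) (xor-comm b c) ⟩
  (d xor c) xor (c xor b)  ≡⟨ xor-cancel-middle d c b ⟩
  d xor b                  ≡⟨ xor-comm d b ⟩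
  b xor d                  ∎
  where open ≡-Reasoning

xor-false : ∀ {a b} → a xor b ≡ false → a ≡ b
xor-false {false} {false} _ = refl
xor-false {true}  {true}  _ = refl
xor-false {false} {true}  ()
xor-false {true}  {false} ()

-- Positions along the boundary are natural numbers; Booleans record order
-- and betweenness so that they can be counted modulo 2.

below : ℕ → ℕ → Bool
below a x with a <? x
... | yes _ = true
... | no _  = false

-- for x ∉ {a, c}: x lies strictly between a and c (exactly one of them is below x)
sep : ℕ → ℕ → ℕ → Bool
sep a c x = below a x xor below c x

below-false : ∀ {a x} → ¬ a < x → below a x ≡ false
below-false {a} {x} a≮x with a <? x
... | yes a<x = contradiction a<x a≮x
... | no _    = refl

below-false⁻¹ : ∀ {a x} → below a x ≡ false → ¬ a < x
below-false⁻¹ {a} {x} eq a<x with a <? x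
below-false⁻¹ () _ | yes _
below-false⁻¹ _ a<x | no a≮x = a≮x a<x

below-flip : ∀ {a x} → a ≢ x → below a x ≡ not (below x a)
below-flip {a} {x} a≢x with a <? x | x <? a
... | yes a<x | yes x<a = contradiction x<a (<-asym a<x)
... | yes _   | no _    = refl
... | no _    | yes _   = refl
... | no a≮x  | no x≮a  = contradiction (≤∧≢⇒< (≮⇒≥ x≮a) a≢x) a≮x

sep-flip : ∀ {a c x} → a ≢ x → c ≢ x → sep a c x ≡ below x a xor below x c
sep-flip {a} {c} {x} a≢x c≢x =
  trans (cong₂ _xor_ (below-flip a≢x) (below-flip c≢x)) (xor-annihilates-not (below x a) (below x c))

sep⇒between : ∀ {a c x} → a ≢ x → c ≢ x → sep a c x ≡ true → (a < x × x < c) ⊎ (c < x × x < a)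
sep⇒between {a} {c} {x} a≢x c≢x s with a <? x | c <? x
... | yes a<x | no c≮x = inj₁ (a<x , ≤∧≢⇒< (≮⇒≥ c≮x) (λ x≡c → c≢x (sym x≡c)))
... | no a≮x  | yes c<x = inj₂ (c<x , ≤∧≢⇒< (≮⇒≥ a≮x) (λ x≡a → a≢x (sym x≡a)))
... | yes _   | yes _  with () ← s
... | no _    | no _   with () ← s

between⇒sep : ∀ {a c x} → (a < x × x < c) ⊎ (c < x × x < a) → sep a c x ≡ true
between⇒sep {a} {c} {x} b with a <? x | c <? x | b
... | yes _   | no _    | _                = refl
... | no _    | yes _   | _                = refl
... | yes _   | yes c<x | inj₁ (_ , x<c)   = contradiction x<c (<-asym c<x)
... | yes a<x | yes _   | inj₂ (_ , x<a)   = contradiction x<a (<-asym a<x)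
... | no a≮x  | no _    | inj₁ (a<x , _)   = contradiction a<x a≮x
... | no _    | no c≮x  | inj₂ (c<x , _)   = contradiction c<x c≮x

sep-chain : ∀ a b c x → sep a b x xor sep b c x ≡ sep a c x
sep-chain a b c x = xor-cancel-middle (below a x) (below b x) (below c x)

sep-prepend : ∀ a b c x {r} → r ≡ sep b c x → sep a b x xor r ≡ sep a c x
sep-prepend a b c x r≡ = trans (cong (sep a b x xor_) r≡) (sep-chain a b c x)

sep-above : ∀ {a c x} → a < x → c < x → sep a c x ≡ false
sep-above {a} {c} {x} a<x c<x with a <? x | c <? x
... | yes _ | yes _  = refl
... | no a≮x | _     = contradiction a<x a≮x
... | yes _ | no c≮x = contradiction c<x c≮x

sep-below : ∀ {a c x} → x < a → x < c → sep a c x ≡ false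
sep-below {a} {c} {x} x<a x<c with a <? x | c <? x
... | no _ | no _     = refl
... | yes a<x | _     = contradiction a<x (<-asym x<a)
... | no _ | yes c<x  = contradiction c<x (<-asym x<c)

upper<lower : ∀ {n} (i j : Fin n) → pos {n} (inj₁ i) < pos {n} (inj₂ j)
upper<lower {n} i j = <-≤-trans (toℕ<n i) (m≤m+n n _)

lower-reversed : ∀ {n} {i j : Fin n} → toℕ j < toℕ i → pos {n} (inj₂ i) < pos {n} (inj₂ j)
lower-reversed {n} {i} j<i = +-monoʳ-< n (∸-monoʳ-< (s≤s j<i) (toℕ<n i))

lower-reversed⁻¹ : ∀ {n} {i j : Fin n} → pos {n} (inj₂ i) < pos {n} (inj₂ j) → toℕ j < toℕ i
lower-reversed⁻¹ {n} lt = ≤-pred (∸-cancelʳ-< {o = n} (+-cancelˡ-< n _ _ lt))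

lower-injective : ∀ {n} {i j : Fin n} → pos {n} (inj₂ i) ≡ pos {n} (inj₂ j) → i ≡ j
lower-injective {n} {i} {j} eq =
  toℕ-injective (suc-injective (∸-cancelˡ-≡ (toℕ<n i) (toℕ<n j) (+-cancelˡ-≡ n _ _ eq)))

below-lower : ∀ {n} (i j : Fin n) → below (pos {n} (inj₂ i)) (pos {n} (inj₂ j)) ≡ below (toℕ j) (toℕ i)
below-lower {n} i j with pos {n} (inj₂ i) <? pos {n} (inj₂ j) | toℕ j <? toℕ i
... | yes _  | yes _  = refl
... | no _   | no _   = refl
... | yes lt | no ¬lt = contradiction (lower-reversed⁻¹ lt) ¬lt
... | no ¬lt | yes lt = contradiction (lower-reversed lt) ¬lt

sep-lower : ∀ {n} {a c y : Fin n} → a ≢ y → c ≢ y →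
  sep (pos {n} (inj₂ a)) (pos {n} (inj₂ c)) (pos {n} (inj₂ y)) ≡ sep (toℕ a) (toℕ c) (toℕ y)
sep-lower {n} {a} {c} {y} a≢y c≢y =
  trans (cong₂ _xor_ (below-lower a y) (below-lower c y))
        (sym (sep-flip {toℕ a} {toℕ c} {toℕ y} (λ e → a≢y (toℕ-injective e)) (λ e → c≢y (toℕ-injective e))))

module Planarity {n : ℕ} (α : Motzkin n) where
  open MotzkinBasics α

  no-crossing : ∀ {a b c d} → P a ≡ just b → P c ≡ just d →
    ¬ (pos a < pos c × pos c < pos b × pos b < pos d)
  no-crossing {a} {b} {c} {d} = noncrossing α a b c d

  enclosed : ∀ {a b c d} → P a ≡ just b → P c ≡ just d →
    pos a ≢ pos c → pos b ≢ pos c → pos a ≢ pos d → pos b ≢ pos d →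
    sep (pos a) (pos b) (pos c) ≡ true → sep (pos a) (pos b) (pos d) ≡ true
  enclosed {a} {b} {c} {d} ab cd a≢c b≢c a≢d b≢d inside
    with sep⇒between a≢c b≢c inside | <-cmp (pos d) (pos a) | <-cmp (pos d) (pos b)
  ... | _                 | tri≈ _ d≡a _ | _           = contradiction (sym d≡a) a≢d
  ... | _                 | _            | tri≈ _ d≡b _ = contradiction (sym d≡b) b≢d
  ... | inj₁ (a<c , c<b) | tri< d<a _ _ | _            = ⊥-elim (no-crossing (partner-sym cd) ab (d<a , a<c , c<b))
  ... | inj₁ (a<c , c<b) | _            | tri> _ _ b<d = ⊥-elim (no-crossing ab cd (a<c , c<b , b<d))
  ... | inj₁ _           | tri> _ _ a<d | tri< d<b _ _ = between⇒sep (inj₁ (a<d , d<b))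
  ... | inj₂ (b<c , c<a) | _            | tri< d<b _ _ = ⊥-elim (no-crossing (partner-sym cd) (partner-sym ab) (d<b , b<c , c<a))
  ... | inj₂ (b<c , c<a) | tri> _ _ a<d | _            = ⊥-elim (no-crossing (partner-sym ab) cd (b<c , c<a , a<d))
  ... | inj₂ _           | tri< d<a _ _ | tri> _ _ b<d = between⇒sep (inj₂ (b<d , d<a))

  same-side : ∀ {a b c d} → P a ≡ just b → P c ≡ just d →
    pos a ≢ pos c → pos b ≢ pos c → pos a ≢ pos d → pos b ≢ pos d →
    sep (pos a) (pos b) (pos c) ≡ sep (pos a) (pos b) (pos d)
  same-side {a} {b} {c} {d} ab cd a≢c b≢c a≢d b≢d
    with sep (pos a) (pos b) (pos c) in c-in | sep (pos a) (pos b) (pos d) in d-in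
  ... | true  | true  = refl
  ... | false | false = refl
  ... | true  | false = contradiction (trans (sym d-in) (enclosed ab cd a≢c b≢c a≢d b≢d c-in)) λ ()
  ... | false | true  =
    contradiction (trans (sym c-in) (enclosed ab (partner-sym cd) a≢d b≢d a≢c b≢c d-in)) λ ()

  upper-arcs-nest : ∀ {a c y z} → P (inj₁ a) ≡ just (inj₁ c) → P (inj₁ y) ≡ just (inj₁ z) →
    a ≢ y → c ≢ y → a ≢ z → c ≢ z → sep (toℕ a) (toℕ c) (toℕ y) ≡ sep (toℕ a) (toℕ c) (toℕ z)
  upper-arcs-nest ac yz a≢y c≢y a≢z c≢z =
    same-side ac yz (a≢y ∘ toℕ-injective) (c≢y ∘ toℕ-injective) (a≢z ∘ toℕ-injective) (c≢z ∘ toℕ-injective)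

  upper-arc-transversal : ∀ {a c y t} → P (inj₁ a) ≡ just (inj₁ c) → P (inj₁ y) ≡ just (inj₂ t) →
    a ≢ y → c ≢ y → sep (toℕ a) (toℕ c) (toℕ y) ≡ false
  upper-arc-transversal {a} {c} {y} {t} ac yt a≢y c≢y =
    trans (same-side ac yt (a≢y ∘ toℕ-injective) (c≢y ∘ toℕ-injective)
                           (<⇒≢ (upper<lower a t)) (<⇒≢ (upper<lower c t)))
          (sep-above (upper<lower a t) (upper<lower c t))

  lower-arcs-nest : ∀ {a c y z} → P (inj₂ a) ≡ just (inj₂ c) → P (inj₂ y) ≡ just (inj₂ z) →
    a ≢ y → c ≢ y → a ≢ z → c ≢ z → sep (toℕ a) (toℕ c) (toℕ y) ≡ sep (toℕ a) (toℕ c) (toℕ z)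
  lower-arcs-nest ac yz a≢y c≢y a≢z c≢z =
    trans (sym (sep-lower a≢y c≢y))
          (trans (same-side ac yz (a≢y ∘ lower-injective) (c≢y ∘ lower-injective)
                                  (a≢z ∘ lower-injective) (c≢z ∘ lower-injective))
                 (sep-lower a≢z c≢z))

  lower-arc-transversal : ∀ {a c y t} → P (inj₂ a) ≡ just (inj₂ c) → P (inj₂ y) ≡ just (inj₁ t) →
    a ≢ y → c ≢ y → sep (toℕ a) (toℕ c) (toℕ y) ≡ false
  lower-arc-transversal {a} {c} {y} {t} ac yt a≢y c≢y =
    trans (sym (sep-lower a≢y c≢y))
          (trans (same-side ac yt (a≢y ∘ lower-injective) (c≢y ∘ lower-injective)
                                  (>⇒≢ (upper<lower t a)) (>⇒≢ (upper<lower t c)))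
                 (sep-below (upper<lower t a) (upper<lower t c)))

  transversals-ordered : ∀ {u a v b} → P (inj₁ u) ≡ just (inj₂ a) → P (inj₁ v) ≡ just (inj₂ b) →
    toℕ u < toℕ v → ¬ (toℕ b < toℕ a)
  transversals-ordered {u} {a} {v} {b} ua vb u<v b<a =
    no-crossing ua vb (u<v , upper<lower v a , lower-reversed b<a)

module Crossings {n : ℕ} (α : Motzkin n) where
  open MotzkinBasics α
  open Planarity α

  upper-crossings : ∀ {c d} → Connected α c d → Fin n → Bool
  upper-crossings ε                       x = false
  upper-crossings (upper {a} {c} _ ◅ w) x = sep (toℕ a) (toℕ c) (toℕ x) xor upper-crossings w x
  upper-crossings (lower _ ◅ w)           x = upper-crossings w x

  lower-crossings : ∀ {c d} → Connected α c d → Fin n → Bool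
  lower-crossings ε                       x = false
  lower-crossings (upper _ ◅ w)           x = lower-crossings w x
  lower-crossings (lower {a} {c} _ ◅ w) x = sep (toℕ a) (toℕ c) (toℕ x) xor lower-crossings w x

  -- each arc of the walk contributes to one of the two counts, and the
  -- contributions telescope to a comparison of x with the ends of the walk
  telescope : ∀ {c d} (w : Connected α c d) x →
    upper-crossings w x xor lower-crossings w x ≡ sep (toℕ c) (toℕ d) (toℕ x)
  telescope {c} ε x = sym (xor-same (below (toℕ c) (toℕ x)))
  telescope {d = d} (upper {a} {c′} _ ◅ w) x =
    trans (xor-assoc (sep (toℕ a) (toℕ c′) (toℕ x)) (upper-crossings w x) (lower-crossings w x))
          (sep-prepend (toℕ a) (toℕ c′) (toℕ d) (toℕ x) (telescope w x))
  telescope {d = d} (lower {a} {c′} _ ◅ w) x =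
    trans (xor-swap (upper-crossings w x) (sep (toℕ a) (toℕ c′) (toℕ x)) (lower-crossings w x))
          (sep-prepend (toℕ a) (toℕ c′) (toℕ d) (toℕ x) (telescope w x))

  apart : ∀ {c a y} → Connected α c a → ¬ Connected α c y → a ≢ y
  apart c~a c≁y refl = c≁y c~a

  -- Arcs outside the component of a walk cannot be separated by it: both
  -- ends of an arc y–z lie on the same side of every arc of the walk, and the
  -- upper end of a transversal block lies outside every upper arc.
  upper-crossings-arc : ∀ {c d y z} (w : Connected α c d) → P (inj₁ y) ≡ just (inj₁ z) →
    ¬ Connected α c y → upper-crossings w y ≡ upper-crossings w z
  upper-crossings-arc ε yz c≁y = refl
  upper-crossings-arc (upper cc′ ◅ w) yz c≁y =
    cong₂ _xor_ (upper-arcs-nest cc′ yz (apart ε c≁y) (apart (upper cc′ ◅ ε) c≁y)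
                                        (apart ε c≁z) (apart (upper cc′ ◅ ε) c≁z))
                (upper-crossings-arc w yz (c≁y ∘ (upper cc′ ◅_)))
    where c≁z = λ c~z → c≁y (c~z ◅◅ (upper (partner-sym yz) ◅ ε))
  upper-crossings-arc (lower cc′ ◅ w) yz c≁y = upper-crossings-arc w yz (c≁y ∘ (lower cc′ ◅_))

  lower-crossings-arc : ∀ {c d y z} (w : Connected α c d) → P (inj₂ y) ≡ just (inj₂ z) →
    ¬ Connected α c y → lower-crossings w y ≡ lower-crossings w z
  lower-crossings-arc ε yz c≁y = refl
  lower-crossings-arc (lower cc′ ◅ w) yz c≁y =
    cong₂ _xor_ (lower-arcs-nest cc′ yz (apart ε c≁y) (apart (lower cc′ ◅ ε) c≁y)
                                        (apart ε c≁z) (apart (lower cc′ ◅ ε) c≁z))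
                (lower-crossings-arc w yz (c≁y ∘ (lower cc′ ◅_)))
    where c≁z = λ c~z → c≁y (c~z ◅◅ (lower (partner-sym yz) ◅ ε))
  lower-crossings-arc (upper cc′ ◅ w) yz c≁y = lower-crossings-arc w yz (c≁y ∘ (upper cc′ ◅_))

  upper-crossings-transversal : ∀ {c d y t} (w : Connected α c d) → P (inj₁ y) ≡ just (inj₂ t) →
    ¬ Connected α c y → upper-crossings w y ≡ false
  upper-crossings-transversal ε yt c≁y = refl
  upper-crossings-transversal (upper cc′ ◅ w) yt c≁y =
    cong₂ _xor_ (upper-arc-transversal cc′ yt (apart ε c≁y) (apart (upper cc′ ◅ ε) c≁y))
                (upper-crossings-transversal w yt (c≁y ∘ (upper cc′ ◅_)))
  upper-crossings-transversal (lower cc′ ◅ w) yt c≁y =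
    upper-crossings-transversal w yt (c≁y ∘ (lower cc′ ◅_))

  lower-crossings-transversal : ∀ {c d y t} (w : Connected α c d) → P (inj₂ y) ≡ just (inj₁ t) →
    ¬ Connected α c y → lower-crossings w y ≡ false
  lower-crossings-transversal ε yt c≁y = refl
  lower-crossings-transversal (lower cc′ ◅ w) yt c≁y =
    cong₂ _xor_ (lower-arc-transversal cc′ yt (apart ε c≁y) (apart (lower cc′ ◅ ε) c≁y))
                (lower-crossings-transversal w yt (c≁y ∘ (lower cc′ ◅_)))
  lower-crossings-transversal (upper cc′ ◅ w) yt c≁y =
    lower-crossings-transversal w yt (c≁y ∘ (upper cc′ ◅_))

  upper-arc-avoids : ∀ {u t y z} → P (inj₁ u) ≡ just (inj₂ t) → P (inj₁ y) ≡ just (inj₁ z) →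
    ¬ Connected α u y → below (toℕ u) (toℕ y) ≡ below (toℕ u) (toℕ z)
  upper-arc-avoids ut yz u≁y =
    xor-false (trans (sym (sep-flip (apart ε u≁y ∘ sym ∘ toℕ-injective) (apart ε u≁z ∘ sym ∘ toℕ-injective)))
                     (upper-arc-transversal yz ut (apart ε u≁y ∘ sym) (apart ε u≁z ∘ sym)))
    where u≁z = λ u~z → u≁y (u~z ◅◅ (upper (partner-sym yz) ◅ ε))

  lower-arc-avoids : ∀ {b t y z} → P (inj₂ b) ≡ just (inj₁ t) → P (inj₂ y) ≡ just (inj₂ z) →
    ¬ Connected α b y → below (toℕ b) (toℕ y) ≡ below (toℕ b) (toℕ z)
  lower-arc-avoids bt yz b≁y =
    xor-false (trans (sym (sep-flip (apart ε b≁y ∘ sym ∘ toℕ-injective) (apart ε b≁z ∘ sym ∘ toℕ-injective)))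
                     (lower-arc-transversal yz bt (apart ε b≁y ∘ sym) (apart ε b≁z ∘ sym)))
    where b≁z = λ b~z → b≁y (b~z ◅◅ (lower (partner-sym yz) ◅ ε))

  -- A walk W from u to b, where the upper side of u and the lower side of b
  -- are active, together with the two transversal blocks, forms a curve
  -- cutting the rectangle in two.  `side x` records on which side of it the
  -- vertex x lies, measured in the upper row; `side′ x` measures the same in
  -- the lower row.
  module ThroughPath {u b t₁ t₂} (W : Connected α u b)
                     (ut : P (inj₁ u) ≡ just (inj₂ t₁)) (bt : P (inj₂ b) ≡ just (inj₁ t₂)) where

    side side′ : Fin n → Bool
    side  x = upper-crossings W x xor below (toℕ u) (toℕ x)
    side′ x = lower-crossings W x xor below (toℕ b) (toℕ x)

    side≡side′ : ∀ x → side x ≡ side′ x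
    side≡side′ x = xor-transpose (upper-crossings W x) (lower-crossings W x) _ _ (telescope W x)

    side-step : ∀ {y z} → ΓEdge α y z → ¬ Connected α u y → side y ≡ side z
    side-step (upper yz) u≁y =
      cong₂ _xor_ (upper-crossings-arc W yz u≁y) (upper-arc-avoids ut yz u≁y)
    side-step {y} {z} (lower yz) u≁y = begin
      side y   ≡⟨ side≡side′ y ⟩
      side′ y  ≡⟨ cong₂ _xor_ (lower-crossings-arc W yz u≁y)
                              (lower-arc-avoids bt yz (λ b~y → u≁y (W ◅◅ b~y))) ⟩
      side′ z  ≡⟨ sym (side≡side′ z) ⟩
      side z   ∎
      where open ≡-Reasoning

    side-constant : ∀ {y z} → Connected α y z → ¬ Connected α u y → side y ≡ side z
    side-constant ε           u≁y = refl
    side-constant (e ◅ y′~z) u≁y =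
      trans (side-step e u≁y) (side-constant y′~z (λ u~y′ → u≁y (u~y′ ◅◅ (Γ-sym e ◅ ε))))

  through-lines-side : ∀ {u b u′ a t₁ t₂ t₃ t₄} →
    P (inj₁ u) ≡ just (inj₂ t₁) → P (inj₂ b) ≡ just (inj₁ t₂) →
    P (inj₁ u′) ≡ just (inj₂ t₃) → P (inj₂ a) ≡ just (inj₁ t₄) →
    Connected α u b → Connected α u′ a → ¬ Connected α u u′ →
    below (toℕ u) (toℕ u′) ≡ below (toℕ b) (toℕ a)
  through-lines-side {u} {b} {u′} {a} ut bt u′t at W Q u≁u′ = begin
    below (toℕ u) (toℕ u′)  ≡⟨ cong (_xor below (toℕ u) (toℕ u′)) (sym (upper-crossings-transversal W u′t u≁u′)) ⟩
    side u′                 ≡⟨ side-constant Q u≁u′ ⟩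
    side a                  ≡⟨ side≡side′ a ⟩
    side′ a                 ≡⟨ cong (_xor below (toℕ b) (toℕ a)) (lower-crossings-transversal W at u≁a) ⟩
    below (toℕ b) (toℕ a)   ∎
    where
    open ≡-Reasoning
    open ThroughPath W ut bt
    u≁a = λ u~a → u≁u′ (u~a ◅◅ connected-sym Q)

  through-lines-ordered : ∀ {u b u′ a t₁ t₂ t₃ t₄} →
    P (inj₁ u) ≡ just (inj₂ t₁) → P (inj₂ b) ≡ just (inj₁ t₂) →
    P (inj₁ u′) ≡ just (inj₂ t₃) → P (inj₂ a) ≡ just (inj₁ t₄) →
    Connected α u b → Connected α u′ a → ¬ Connected α u u′ →
    toℕ a < toℕ b → toℕ u′ < toℕ u
  through-lines-ordered ut bt u′t at W Q u≁u′ a<b =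
    ≤∧≢⇒< (≮⇒≥ (below-false⁻¹ (trans (through-lines-side ut bt u′t at W Q u≁u′) (below-false (<-asym a<b)))))
          (apart ε u≁u′ ∘ sym ∘ toℕ-injective)

-- In a graph of maximum degree two, a vertex of degree at most one is
-- connected to at most one other vertex of degree at most one: walking
-- away from it without backtracking, there is only one way to go.
module MaxDegreeTwo {A : Set} (_≟A_ : (x y : A) → Dec (x ≡ y)) (Adj : A → A → Set)
  (adj-sym : ∀ {x y} → Adj x y → Adj y x)
  (degree≤2 : ∀ {x q y y′} → Adj x q → Adj x y → Adj x y′ → y ≢ q → y′ ≢ q → y ≡ y′) where

  End : A → Set
  End x = ∀ {y y′} → Adj x y → Adj x y′ → y ≡ y′

  module NonBacktracking (s₀ : A) (end₀ : End s₀) where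

    data Walk : ℕ → A → Maybe A → Set where
      start : Walk 0 s₀ nothing
      step  : ∀ {l x y p} → Walk l x p → Adj x y → p ≢ just y → Walk (suc l) y (just x)

    came-from : ∀ {l x q} → Walk l x (just q) → Adj x q
    came-from (step _ e _) = adj-sym e

    at-start : ∀ {l x} → Walk l x nothing → x ≡ s₀
    at-start start = refl

    unique : ∀ {l x x′ p p′} → Walk l x p → Walk l x′ p′ → x ≡ x′ × p ≡ p′
    unique start start = refl , refl
    unique (step {p = p} w e ¬back) (step w′ e′ ¬back′) with unique w w′
    ... | refl , refl with p
    ...   | nothing rewrite at-start w = end₀ e e′ , refl
    ...   | just q  = degree≤2 (came-from w) e e′ (¬back ∘ cong just ∘ sym) (¬back′ ∘ cong just ∘ sym) , refl

    Reached : A → Set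
    Reached x = Σ ℕ λ l → Σ (Maybe A) λ p → Walk l x p

    reduce : ∀ {l x p t} → Walk l x p → Star Adj x t → Reached t
    reduce w ε = _ , _ , w
    reduce {p = p} w (_◅_ {j = y} e rest) with Maybe.≡-dec _≟A_ p (just y)
    reduce (step w′ _ _) (_ ◅ rest) | yes refl = reduce w′ rest
    ... | no ¬back = reduce (step w e ¬back) rest

    truncate : ∀ {l x p} → Walk l x p → ∀ k → k ≤ l → Σ A λ y → Σ (Maybe A) (Walk k y)
    truncate start zero z≤n = _ , _ , start
    truncate (step {l = l} w e ¬back) k k≤1+l with k ≟ suc l
    ... | yes refl = _ , _ , step w e ¬back
    ... | no k≢1+l = truncate w k (≤-pred (≤∧≢⇒< k≤1+l k≢1+l))

    stops-at-end : ∀ {l₁ l₂ x₁ x₂ p₁ p₂} → Walk l₁ x₁ p₁ → Walk l₂ x₂ p₂ →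
      End x₁ → x₁ ≢ s₀ → ¬ l₁ < l₂
    stops-at-end {l₁} w₁ w₂ end₁ x₁≢s₀ l₁<l₂ with truncate w₂ (suc l₁) l₁<l₂
    ... | _ , _ , step w e ¬back with unique w₁ w
    ...   | refl , refl with w₁
    ...     | start      = x₁≢s₀ refl
    ...     | step _ _ _ = ¬back (cong just (end₁ (came-from w₁) e))

    ends-coincide : ∀ {l₁ l₂ x₁ x₂ p₁ p₂} → Walk l₁ x₁ p₁ → Walk l₂ x₂ p₂ →
      End x₁ → End x₂ → x₁ ≢ s₀ → x₂ ≢ s₀ → x₁ ≡ x₂
    ends-coincide {l₁} {l₂} w₁ w₂ end₁ end₂ x₁≢s₀ x₂≢s₀ with <-cmp l₁ l₂
    ... | tri< l₁<l₂ _ _ = contradiction l₁<l₂ (stops-at-end w₁ w₂ end₁ x₁≢s₀)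
    ... | tri> _ _ l₂<l₁ = contradiction l₂<l₁ (stops-at-end w₂ w₁ end₂ x₂≢s₀)
    ... | tri≈ _ refl _  = proj₁ (unique w₁ w₂)

  at-most-two-ends : ∀ {s₀ s₁ s₂} → End s₀ → End s₁ → End s₂ →
    Star Adj s₀ s₁ → Star Adj s₀ s₂ → s₁ ≢ s₀ → s₂ ≢ s₀ → s₁ ≡ s₂
  at-most-two-ends {s₀} end₀ end₁ end₂ p₁ p₂ s₁≢s₀ s₂≢s₀ =
    ends-coincide (proj₂ (proj₂ (reduce start p₁))) (proj₂ (proj₂ (reduce start p₂))) end₁ end₂ s₁≢s₀ s₂≢s₀
    where open NonBacktracking s₀ end₀

-- The sides of the vertices of Γ(α), joined when they are the two sides of
-- one vertex or form a block of α in one row, form a graph of maximum degree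
-- two whose uncovered sides are ends.  The components of Γ(α) correspond to
-- those of this graph, and free ends to its ends.
module FreeEnds {n : ℕ} (α : Motzkin n) where
  open MotzkinBasics α

  opposite : V n → V n
  opposite (inj₁ i) = inj₂ i
  opposite (inj₂ i) = inj₁ i

  SideAdj : V n → V n → Set
  SideAdj s t = t ≡ opposite s ⊎ (P s ≡ just t × isUpper s ≡ isUpper t)

  side-adj-sym : ∀ {s t} → SideAdj s t → SideAdj t s
  side-adj-sym {inj₁ _} (inj₁ refl)         = inj₁ refl
  side-adj-sym {inj₂ _} (inj₁ refl)         = inj₁ refl
  side-adj-sym          (inj₂ (st , same)) = inj₂ (partner-sym st , sym same)

  neighbour : ∀ {s t} → SideAdj s t → t ≡ opposite s ⊎ P s ≡ just t
  neighbour (inj₁ t≡s′)      = inj₁ t≡s′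
  neighbour (inj₂ (st , _)) = inj₂ st

  side-degree≤2 : ∀ {x q y y′} → SideAdj x q → SideAdj x y → SideAdj x y′ → y ≢ q → y′ ≢ q → y ≡ y′
  side-degree≤2 xq xy xy′ y≢q y′≢q with neighbour xq | neighbour xy | neighbour xy′
  ... | _         | inj₁ y≡x′ | inj₁ y′≡x′ = trans y≡x′ (sym y′≡x′)
  ... | _         | inj₂ xy   | inj₂ xy′   = partner-functional xy xy′
  ... | inj₁ q≡x′ | inj₁ y≡x′ | inj₂ _     = contradiction (trans y≡x′ (sym q≡x′)) y≢q
  ... | inj₂ xq   | inj₁ _    | inj₂ xy′   = contradiction (partner-functional xy′ xq) y′≢q
  ... | inj₁ q≡x′ | inj₂ _    | inj₁ y′≡x′ = contradiction (trans y′≡x′ (sym q≡x′)) y′≢q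
  ... | inj₂ xq   | inj₂ xy   | inj₁ _     = contradiction (partner-functional xy xq) y≢q

  open MaxDegreeTwo _≟V_ SideAdj side-adj-sym side-degree≤2

  uncovered-end : ∀ {s} → ¬ Covered α s → End s
  uncovered-end ¬cov (inj₁ y≡s′) (inj₁ y′≡s′) = trans y≡s′ (sym y′≡s′)
  uncovered-end ¬cov (inj₂ (st , same)) _     = contradiction (_ , st , same) ¬cov
  uncovered-end ¬cov _ (inj₂ (st , same))     = contradiction (_ , st , same) ¬cov

  upper-walk : ∀ {a b} → Connected α a b → Star SideAdj (inj₁ a) (inj₁ b)
  upper-walk ε              = ε
  upper-walk (upper ac ◅ w) = inj₂ (ac , refl) ◅ upper-walk w
  upper-walk (lower ac ◅ w) = inj₁ refl ◅ inj₂ (ac , refl) ◅ inj₁ refl ◅ upper-walk w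

  to-upper : ∀ s → Star SideAdj s (inj₁ (vertexOf s))
  to-upper (inj₁ _) = ε
  to-upper (inj₂ _) = inj₁ refl ◅ ε

  side-walk : ∀ {s t} → Connected α (vertexOf s) (vertexOf t) → Star SideAdj s t
  side-walk {s} {t} w = to-upper s ◅◅ upper-walk w ◅◅ reverse side-adj-sym (to-upper t)

  at-most-two-free-ends : ∀ {r s₁ s₂ s₃} → FreeEnd α r s₁ → FreeEnd α r s₂ → FreeEnd α r s₃ →
    s₁ ≢ s₂ → s₃ ≡ s₁ ⊎ s₃ ≡ s₂
  at-most-two-free-ends {s₁ = s₁} {s₂} {s₃} (r~s₁ , ¬cov₁) (r~s₂ , ¬cov₂) (r~s₃ , ¬cov₃) s₁≢s₂
    with s₃ ≟V s₁
  ... | yes s₃≡s₁ = inj₁ s₃≡s₁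
  ... | no s₃≢s₁  = inj₂ (sym (at-most-two-ends (uncovered-end ¬cov₁) (uncovered-end ¬cov₂) (uncovered-end ¬cov₃)
                               (side-walk (connected-sym r~s₁ ◅◅ r~s₂)) (side-walk (connected-sym r~s₁ ◅◅ r~s₃))
                               (s₁≢s₂ ∘ sym) s₃≢s₁))

module ClassifiedComponents {n : ℕ} (α : Motzkin n)
  (classified : ∀ r → IsCycle α r ⊎ IsInertPath α r ⊎ IsTransActivePath α r) where
  open MotzkinBasics α
  open Planarity α using (transversals-ordered)
  open Crossings α using (through-lines-ordered)

  cycle-covered : ∀ {r s} → IsCycle α r → Connected α r (vertexOf s) → Covered α s
  cycle-covered {s = inj₁ _} cycle r~s = proj₁ (cycle _ r~s)
  cycle-covered {s = inj₂ _} cycle r~s = proj₂ (cycle _ r~s)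

  -- an active side is a free end, so its component is a trans-active path
  active⇒trans-active : ∀ {r s} → Connected α r (vertexOf s) → Active α s → IsTransActivePath α r
  active⇒trans-active {r} r~s act with classified r
  ... | inj₁ cycle                   = contradiction (cycle-covered cycle r~s) (active⇒¬covered act)
  ... | inj₂ (inj₁ (_ , ends-inert)) = contradiction (ends-inert _ (r~s , active⇒¬covered act)) (active⇒¬inert act)
  ... | inj₂ (inj₂ trans-active)     = trans-active

  one-active-upper : ∀ {r x y} → Connected α r x → Connected α r y →
    Active α (inj₁ x) → Active α (inj₁ y) → x ≡ y
  one-active-upper {r} {x} {y} r~x r~y ax ay with active⇒trans-active r~x ax
  ... | _ , i , j , ends , _ = trans (upper-end (to (ends (inj₁ x)) (r~x , active⇒¬covered ax)))
                                     (sym (upper-end (to (ends (inj₁ y)) (r~y , active⇒¬covered ay))))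
    where
    open Equivalence
    upper-end : ∀ {z} → inj₁ z ≡ inj₁ i ⊎ inj₁ z ≡ inj₂ j → z ≡ i
    upper-end (inj₁ eq) = inj₁-injective eq

  one-active-lower : ∀ {r x y} → Connected α r x → Connected α r y →
    Active α (inj₂ x) → Active α (inj₂ y) → x ≡ y
  one-active-lower {r} {x} {y} r~x r~y ax ay with active⇒trans-active r~x ax
  ... | _ , i , j , ends , _ = trans (lower-end (to (ends (inj₂ x)) (r~x , active⇒¬covered ax)))
                                     (sym (lower-end (to (ends (inj₂ y)) (r~y , active⇒¬covered ay))))
    where
    open Equivalence
    lower-end : ∀ {z} → inj₂ z ≡ inj₁ i ⊎ inj₂ z ≡ inj₂ j → z ≡ j
    lower-end (inj₂ eq) = inj₂-injective eq

  active-lower-in : ∀ {r s} → Connected α r (vertexOf s) → Active α s → ActiveLowerIn r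
  active-lower-in r~s act with active⇒trans-active r~s act
  ... | _ , _ , j , ends , _ , aj = j , proj₁ (Equivalence.from (ends (inj₂ j)) (inj₂ refl)) , aj

  active-upper-in : ∀ {r s} → Connected α r (vertexOf s) → Active α s → ActiveUpperIn r
  active-upper-in r~s act with active⇒trans-active r~s act
  ... | _ , i , _ , ends , ai , _ = i , proj₁ (Equivalence.from (ends (inj₁ i)) (inj₁ refl)) , ai

  Joined : Fin n → Set
  Joined u = ∀ {a} → P (inj₁ u) ≡ just (inj₂ a) → Connected α u a

  -- Let {u, a′} be a transversal block and j the active lower side in the
  -- component of u.  Assuming the claim for vertices left of u, a = j.
  module JoinedStep {u a j} (joined-left : ∀ {u′} → toℕ u′ < toℕ u → Joined u′)
                    (ua : P (inj₁ u) ≡ just (inj₂ a)) (u~j : Connected α u j) (aj : Active α (inj₂ j)) where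

    -- the block {u″, j′} at j can neither cross {u, a′}, nor start at u (as
    -- a ≠ j), nor start left of u, where by the claim for u″ it would give
    -- a second active upper side in the component of u
    ¬j<a : ¬ toℕ j < toℕ a
    ¬j<a j<a with active-lower aj
    ... | u″ , ju″ with <-cmp (toℕ u″) (toℕ u)
    ...   | tri> _ _ u<u″ = transversals-ordered ua (partner-sym ju″) u<u″ j<a
    ...   | tri≈ _ u″≡u _ with refl ← toℕ-injective u″≡u
                          with refl ← partner-functional (partner-sym ju″) ua = <-irrefl refl j<a
    ...   | tri< u″<u _ _ = <-irrefl (cong toℕ u″≡u) u″<u
      where
      u″j : P (inj₁ u″) ≡ just (inj₂ j)
      u″j = partner-sym ju″
      u″≡u : u″ ≡ u
      u″≡u = one-active-upper (u~j ◅◅ connected-sym (joined-left u″<u u″j)) ε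
                              (transversal-upper u″j) (transversal-upper ua)

    -- if a < j and a were in another component, the active upper side i of
    -- that component would lie left of u; by the claim for i its block ends
    -- in the component of a, hence at a, so i = u
    a<j⇒joined : toℕ a < toℕ j → Connected α u a
    a<j⇒joined a<j with connected? u a
    ... | yes u~a = u~a
    ... | no u≁a with active-upper-in {r = a} {s = inj₂ a} ε (transversal-lower (partner-sym ua))
    ...   | i , a~i , ai with active-upper ai | active-lower aj
    ...     | c , ic | _ , jt = contradiction (cong toℕ i≡u) (<⇒≢ i<u)
      where
      i<u : toℕ i < toℕ u
      i<u = through-lines-ordered ua jt ic (partner-sym ua) u~j (connected-sym a~i)
                                  (λ u~i → u≁a (u~i ◅◅ connected-sym a~i)) a<j
      a≡c : a ≡ c
      a≡c = one-active-lower ε (a~i ◅◅ joined-left i<u ic)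
                             (transversal-lower (partner-sym ua)) (transversal-lower (partner-sym ic))
      i≡u : i ≡ u
      i≡u = inj₁-injective (partner-injective ic (subst (λ z → P (inj₁ u) ≡ just (inj₂ z)) a≡c ua))

  transversal-joined : ∀ u → Joined u
  transversal-joined = All.wfRec FinInduction.<-wellFounded 0ℓ Joined step
    where
    step : ∀ u → (∀ {u′} → toℕ u′ < toℕ u → Joined u′) → Joined u
    step u joined-left {a} ua with active-lower-in {r = u} {s = inj₁ u} ε (transversal-upper ua)
    ... | j , u~j , aj with <-cmp (toℕ a) (toℕ j)
    ...   | tri< a<j _ _ = JoinedStep.a<j⇒joined joined-left ua u~j aj a<j
    ...   | tri≈ _ a≡j _ = subst (Connected α u) (sym (toℕ-injective a≡j)) u~j
    ...   | tri> _ _ j<a = contradiction j<a (JoinedStep.¬j<a joined-left ua u~j aj)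

propagate : ∀ {A : Set} {R : A → A → Set} {x₀} (S : A → Set) →
  (∀ {u v} → Star R x₀ u → R u v → S u → S v) → ∀ {v} → Star R x₀ v → S x₀ → S v
propagate {R = R} {x₀} S preserved = go ε
  where
  go : ∀ {u v} → Star R x₀ u → Star R u v → S u → S v
  go before ε       s = s
  go before (e ◅ p) s = go (before ◅◅ (e ◅ ε)) p (preserved before e s)

module Stacking {n : ℕ} (α : Motzkin n) where
  open MotzkinBasics α

  Edge : W n → W n → Set
  Edge = StackEdge (blocks α) (blocks α)

  -- the lower blocks of the upper copy and the upper blocks of the lower copy
  -- together form Γ(α) in the middle row
  Γ-lift : ∀ {a b} → Connected α a b → Star Edge (mid , a) (mid , b)
  Γ-lift ε                      = ε
  Γ-lift (upper {a} {c} ac ◅ w) = fromβ {x = inj₁ a} {y = inj₁ c} (inj₂ ac) ◅ Γ-lift w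
  Γ-lift (lower {a} {c} ac ◅ w) = fromα {x = inj₂ a} {y = inj₂ c} (inj₂ ac) ◅ Γ-lift w

module SquareOfClassified {n : ℕ} (α : Motzkin n)
  (classified : ∀ r → IsCycle α r ⊎ IsInertPath α r ⊎ IsTransActivePath α r) where
  open MotzkinBasics α
  open ClassifiedComponents α classified
  open Stacking α

  -- every block of α is a block of α²; a transversal block {k, m′} is
  -- realised by the path k — m (upper copy), m ~ k in Γ(α), k — m′ (lower copy)
  blocks⊆square : ∀ x y → blocks α x y → (blocks α ⊙ blocks α) x y
  blocks⊆square x .x (inj₁ refl) = ε
  blocks⊆square (inj₁ a) (inj₁ b) (inj₂ ab) = fromα {x = inj₁ a} {y = inj₁ b} (inj₂ ab) ◅ ε
  blocks⊆square (inj₂ a) (inj₂ b) (inj₂ ab) = fromβ {x = inj₂ a} {y = inj₂ b} (inj₂ ab) ◅ ε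
  blocks⊆square (inj₁ k) (inj₂ m) (inj₂ km) =
    fromα {x = inj₁ k} {y = inj₂ m} (inj₂ km) ◅
    Γ-lift (connected-sym (transversal-joined k km)) ◅◅ (fromβ {x = inj₁ k} {y = inj₂ m} (inj₂ km) ◅ ε)
  blocks⊆square (inj₂ m) (inj₁ k) (inj₂ mk) =
    fromβ {x = inj₂ m} {y = inj₁ k} (inj₂ mk) ◅
    Γ-lift (transversal-joined k (partner-sym mk)) ◅◅ (fromα {x = inj₂ m} {y = inj₁ k} (inj₂ mk) ◅ ε)

  module FromUpper (a : Fin n) (¬act : ¬ Active α (inj₁ a)) where
    Reach : W n → Set
    Reach (top , i) = blocks α (inj₁ a) (inj₁ i)
    Reach (mid , _) = ⊥
    Reach (bot , _) = ⊥

    preserved : ∀ {u v} → Edge u v → Reach u → Reach v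
    preserved (fromα {inj₁ i} (inj₁ refl))          s           = s
    preserved (fromα {inj₁ i} {inj₁ j} (inj₂ ij)) (inj₁ refl) = inj₂ ij
    preserved (fromα {inj₁ i} {inj₁ j} (inj₂ ij)) (inj₂ ai)   = inj₁ (sym (partner-functional ij (partner-sym ai)))
    preserved (fromα {inj₁ i} {inj₂ j} (inj₂ ij)) (inj₁ refl) = contradiction (transversal-upper ij) ¬act
    preserved (fromα {inj₁ i} {inj₂ j} (inj₂ ij)) (inj₂ ai)   with () ← partner-functional ij (partner-sym ai)
    preserved (fromα {inj₂ _} _) ()
    preserved (fromβ {inj₁ _} _) ()
    preserved (fromβ {inj₂ _} _) ()

    reach : ∀ y → Star Edge (top , a) (ιᵒ y) → blocks α (inj₁ a) y
    reach (inj₁ b) w = propagate Reach (λ _ → preserved) w (inj₁ refl)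
    reach (inj₂ b) w with () ← propagate Reach (λ _ → preserved) w (inj₁ refl)

  module FromLower (a : Fin n) (¬act : ¬ Active α (inj₂ a)) where
    Reach : W n → Set
    Reach (top , _) = ⊥
    Reach (mid , _) = ⊥
    Reach (bot , i) = blocks α (inj₂ a) (inj₂ i)

    preserved : ∀ {u v} → Edge u v → Reach u → Reach v
    preserved (fromβ {inj₂ i} (inj₁ refl))          s           = s
    preserved (fromβ {inj₂ i} {inj₂ j} (inj₂ ij)) (inj₁ refl) = inj₂ ij
    preserved (fromβ {inj₂ i} {inj₂ j} (inj₂ ij)) (inj₂ ai)   = inj₁ (sym (partner-functional ij (partner-sym ai)))
    preserved (fromβ {inj₂ i} {inj₁ j} (inj₂ ij)) (inj₁ refl) = contradiction (transversal-lower ij) ¬act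
    preserved (fromβ {inj₂ i} {inj₁ j} (inj₂ ij)) (inj₂ ai)   with () ← partner-functional ij (partner-sym ai)
    preserved (fromβ {inj₁ _} _) ()
    preserved (fromα {inj₁ _} _) ()
    preserved (fromα {inj₂ _} _) ()

    reach : ∀ y → Star Edge (bot , a) (ιᵒ y) → blocks α (inj₂ a) y
    reach (inj₂ b) w = propagate Reach (λ _ → preserved) w (inj₁ refl)
    reach (inj₁ b) w with () ← propagate Reach (λ _ → preserved) w (inj₁ refl)

  -- from either end of a transversal block {k, m′}, α² reaches k at the top,
  -- the component of m in the middle and m at the bottom, because that
  -- component has no other active lower side
  module Through (k m : Fin n) (km : P (inj₁ k) ≡ just (inj₂ m)) where
    Reach : W n → Set
    Reach (top , i) = i ≡ k
    Reach (mid , i) = Connected α m i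
    Reach (bot , i) = i ≡ m

    m-active : Active α (inj₂ m)
    m-active = transversal-lower (partner-sym km)

    preserved : ∀ {u v} → Edge u v → Reach u → Reach v
    preserved (fromα {inj₁ i} (inj₁ refl)) s = s
    preserved (fromα {inj₁ i} (inj₂ iy)) refl with refl ← partner-functional iy km = ε
    preserved (fromα {inj₂ i} (inj₁ refl)) s = s
    preserved (fromα {inj₂ i} {inj₂ j} (inj₂ ij)) m~i = m~i ◅◅ (lower ij ◅ ε)
    preserved (fromα {inj₂ i} {inj₁ j} (inj₂ ij)) m~i
      with refl ← one-active-lower ε m~i m-active (transversal-lower ij)
      = inj₁-injective (partner-functional ij (partner-sym km))
    preserved (fromβ {inj₁ i} (inj₁ refl)) s = s
    preserved (fromβ {inj₁ i} {inj₁ j} (inj₂ ij)) m~i = m~i ◅◅ (upper ij ◅ ε)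
    preserved (fromβ {inj₁ i} {inj₂ j} (inj₂ ij)) m~i =
      sym (one-active-lower ε (m~i ◅◅ transversal-joined i ij) m-active (transversal-lower (partner-sym ij)))
    preserved (fromβ {inj₂ i} (inj₁ refl)) s = s
    preserved (fromβ {inj₂ i} (inj₂ iy)) refl with refl ← partner-functional iy (partner-sym km) =
      connected-sym (transversal-joined k km)

    from-top : ∀ y → Star Edge (top , k) (ιᵒ y) → blocks α (inj₁ k) y
    from-top (inj₁ b) w with refl ← propagate Reach (λ _ → preserved) w refl = inj₁ refl
    from-top (inj₂ b) w with refl ← propagate Reach (λ _ → preserved) w refl = inj₂ km

    from-bottom : ∀ y → Star Edge (bot , m) (ιᵒ y) → blocks α (inj₂ m) y
    from-bottom (inj₁ b) w with refl ← propagate Reach (λ _ → preserved) w refl = inj₂ (partner-sym km)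
    from-bottom (inj₂ b) w with refl ← propagate Reach (λ _ → preserved) w refl = inj₁ refl

  square⊆blocks : ∀ x y → (blocks α ⊙ blocks α) x y → blocks α x y
  square⊆blocks (inj₁ a) y w with active? (inj₁ a)
  ... | no ¬act = FromUpper.reach a ¬act y w
  ... | yes act with active-upper act
  ...   | m , am = Through.from-top a m am y w
  square⊆blocks (inj₂ a) y w with active? (inj₂ a)
  ... | no ¬act = FromLower.reach a ¬act y w
  ... | yes act with active-lower act
  ...   | k , ak = Through.from-bottom k a (partner-sym ak) y w

  idempotent : (blocks α ⊙ blocks α) ≐ blocks α
  idempotent x y = mk⇔ (square⊆blocks x y) (blocks⊆square x y)

module ClassificationOfIdempotent {n : ℕ} (α : Motzkin n) (idempotent : (blocks α ⊙ blocks α) ≐ blocks α) where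
  open MotzkinBasics α
  open Stacking α
  open FreeEnds α using (at-most-two-free-ends)

  square⇒block : ∀ x y → Star Edge (ιᵒ x) (ιᵒ y) → blocks α x y
  square⇒block x y = Equivalence.to (idempotent x y)

  block⇒square : ∀ x y → blocks α x y → Star Edge (ιᵒ x) (ιᵒ y)
  block⇒square x y = Equivalence.from (idempotent x y)

  -- If m lies in the component of r and {k, m′} is a block, then so does k:
  -- otherwise the path from k to m′ in α² would have to cross from the
  -- component of r in the middle row to the bottom, by a transversal block
  -- {i, j′} of the lower copy; but then {k, j′} is a block of α² = α, so
  -- j = m and i = k.
  module LowerEndJoined {r m k : Fin n} (r~m : Connected α r m) (mk : P (inj₂ m) ≡ just (inj₁ k))
                        (r≁k : ¬ Connected α r k) where
    Reach : W n → Set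
    Reach (top , i) = i ≡ k
    Reach (mid , i) = Connected α r i
    Reach (bot , _) = ⊥

    preserved : ∀ {u v} → Star Edge (top , k) u → Edge u v → Reach u → Reach v
    preserved _ (fromα {inj₁ i} (inj₁ refl)) s = s
    preserved _ (fromα {inj₁ i} (inj₂ iy)) refl with refl ← partner-functional iy (partner-sym mk) = r~m
    preserved _ (fromα {inj₂ i} (inj₁ refl)) s = s
    preserved _ (fromα {inj₂ i} {inj₂ j} (inj₂ ij)) r~i = r~i ◅◅ (lower ij ◅ ε)
    preserved before (fromα {inj₂ i} {inj₁ j} (inj₂ ij)) r~i
      with square⇒block (inj₁ k) (inj₁ j) (before ◅◅ (fromα {x = inj₂ i} {y = inj₁ j} (inj₂ ij) ◅ ε))
    ... | inj₁ k≡j = sym (inj₁-injective k≡j)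
    ... | inj₂ kj with () ← partner-functional kj (partner-sym mk)
    preserved _ (fromβ {inj₁ i} (inj₁ refl)) s = s
    preserved _ (fromβ {inj₁ i} {inj₁ j} (inj₂ ij)) r~i = r~i ◅◅ (upper ij ◅ ε)
    preserved before (fromβ {inj₁ i} {inj₂ j} (inj₂ ij)) r~i
      with square⇒block (inj₁ k) (inj₂ j) (before ◅◅ (fromβ {x = inj₁ i} {y = inj₂ j} (inj₂ ij) ◅ ε))
    ... | inj₂ kj with refl ← partner-functional kj (partner-sym mk)
                  with refl ← partner-injective ij kj = r≁k r~i
    preserved _ (fromβ {inj₂ _} _) ()

    impossible : ⊥
    impossible = propagate Reach preserved (block⇒square (inj₁ k) (inj₂ m) (inj₂ (partner-sym mk))) refl

  lower-end-joined : ∀ {r m k} → Connected α r m → P (inj₂ m) ≡ just (inj₁ k) → Connected α r k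
  lower-end-joined {r} {m} {k} r~m mk with connected? r k
  ... | yes r~k = r~k
  ... | no r≁k  = ⊥-elim (LowerEndJoined.impossible r~m mk r≁k)

  -- If v lies in the component of r and {v, j′} is a block, the component has
  -- an active lower side: otherwise the path from j′ to v in α² could never
  -- leave the middle row upwards, and {j′, j″} is a block only for j″ = j.
  module LowerSideFound {r v j : Fin n} (r~v : Connected α r v) (vj : P (inj₁ v) ≡ just (inj₂ j))
                        (none : ¬ ActiveLowerIn r) where
    Reach : W n → Set
    Reach (top , _) = ⊥
    Reach (mid , i) = Connected α r i
    Reach (bot , i) = i ≡ j

    preserved : ∀ {u v} → Star Edge (bot , j) u → Edge u v → Reach u → Reach v
    preserved _ (fromα {inj₁ _} _) ()
    preserved _ (fromα {inj₂ i} (inj₁ refl)) s = s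
    preserved _ (fromα {inj₂ i} {inj₂ x} (inj₂ ix)) r~i = r~i ◅◅ (lower ix ◅ ε)
    preserved _ (fromα {inj₂ i} {inj₁ x} (inj₂ ix)) r~i = none (i , r~i , transversal-lower ix)
    preserved _ (fromβ {inj₁ i} (inj₁ refl)) s = s
    preserved _ (fromβ {inj₁ i} {inj₁ x} (inj₂ ix)) r~i = r~i ◅◅ (upper ix ◅ ε)
    preserved before (fromβ {inj₁ i} {inj₂ x} (inj₂ ix)) r~i
      with square⇒block (inj₂ j) (inj₂ x) (before ◅◅ (fromβ {x = inj₁ i} {y = inj₂ x} (inj₂ ix) ◅ ε))
    ... | inj₁ j≡x = sym (inj₂-injective j≡x)
    ... | inj₂ jx with () ← partner-functional jx (partner-sym vj)
    preserved _ (fromβ {inj₂ i} (inj₁ refl)) s = s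
    preserved _ (fromβ {inj₂ i} (inj₂ iy)) refl with refl ← partner-functional iy (partner-sym vj) = r~v

    impossible : ⊥
    impossible = propagate Reach preserved (block⇒square (inj₂ j) (inj₁ v) (inj₂ (partner-sym vj))) refl

  active-lower-found : ∀ {r i} → Connected α r i → Active α (inj₁ i) ⊎ Active α (inj₂ i) → ActiveLowerIn r
  active-lower-found {r} {i} r~i (inj₂ act) = i , r~i , act
  active-lower-found {r} {i} r~i (inj₁ act)
    with active-upper act | any? (λ x → connected? r x ×-dec active? (inj₂ x))
  ... | _ , ij | yes found = found
  ... | _ , ij | no none   = ⊥-elim (LowerSideFound.impossible r~i ij none)

  inert-path : ∀ {r} → ¬ (Σ (Fin n) λ i → Connected α r i × (Active α (inj₁ i) ⊎ Active α (inj₂ i))) →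
    ∀ s → FreeEnd α r s → Inert α s
  inert-path none s (r~s , ¬cov) with status s
  ... | covered cov = contradiction cov ¬cov
  ... | inert ine   = ine
  inert-path none (inj₁ i) (r~i , _) | active act = ⊥-elim (none (i , r~i , inj₁ act))
  inert-path none (inj₂ i) (r~i , _) | active act = ⊥-elim (none (i , r~i , inj₂ act))

  trans-active-path : ∀ {r} → IsPath α r → ActiveLowerIn r → IsTransActivePath α r
  trans-active-path {r} path (m , r~m , act) with active-lower act
  ... | k , mk = path , k , m , ends , transversal-upper (partner-sym mk) , act
    where
    k-end : FreeEnd α r (inj₁ k)
    k-end = lower-end-joined r~m mk , active⇒¬covered (transversal-upper (partner-sym mk))
    m-end : FreeEnd α r (inj₂ m)
    m-end = r~m , active⇒¬covered act
    is-end : ∀ {s} → s ≡ inj₁ k ⊎ s ≡ inj₂ m → FreeEnd α r s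
    is-end (inj₁ refl) = k-end
    is-end (inj₂ refl) = m-end
    ends : ∀ s → FreeEnd α r s ⇔ (s ≡ inj₁ k ⊎ s ≡ inj₂ m)
    ends s = mk⇔ (λ s-end → swap (at-most-two-free-ends m-end k-end s-end λ ())) is-end

  classification : ∀ r → IsCycle α r ⊎ IsInertPath α r ⊎ IsTransActivePath α r
  classification r with all? (λ i → connected? r i →-dec (covered? (inj₁ i) ×-dec covered? (inj₂ i)))
  ... | yes cycle = inj₁ cycle
  ... | no path with any? (λ i → connected? r i ×-dec (active? (inj₁ i) ⊎-dec active? (inj₂ i)))
  ...   | no none              = inj₂ (inj₁ (path , inert-path none))
  ...   | yes (i , r~i , act) = inj₂ (inj₂ (trans-active-path path (active-lower-found r~i act)))

-- α² = α exactly when Γ(α) is classified.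
proposition2p1 : (n : ℕ) → 1 ≤ n → (α : Motzkin n) →
    ((blocks α ⊙ blocks α) ≐ blocks α) ⇔
    (∀ r → IsCycle α r ⊎ IsInertPath α r ⊎ IsTransActivePath α r)
proposition2p1 n _ α =
  mk⇔ (ClassificationOfIdempotent.classification α) (SquareOfClassified.idempotent α)
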